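{- The only non-negative integer $n$ such that $n!$ is a perfect number (i.e. $\sigma(n!) = 2\cdot n!$) is $n = 3$.
   Context: $\sigma(m)$ is the sum of the positive divisors of $m$. -}

module Defs where

open import Data.Nat using (ℕ; zero; suc; _+_)
open import Data.Nat.Divisibility using (_∣?_)
open import Relation.Nullary.Decidable using (yes; no)

σ-upto : ℕ → ℕ → ℕ
σ-upto m zero = 0
σ-upto m (suc k) with suc k ∣? m
... | yes _ = suc k + σ-upto m k
... | no _  = σ-upto m k

-- σ m : sum of the positive divisors of m (all lie in 1..m when m > 0)
σ : ℕ → ℕ
σ m = σ-upto m m

module Submission where

-- For n ≥ 4 the factorial is a
-- positive multiple of 12, and every such number m = 12b is abundant: its
-- distinct divisors 12b > 6b > 4b > 3b already sum to 25b > 24b = 2m.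

open import Defs
open import Data.Nat using (ℕ; _*_; _!)
open import Relation.Binary.PropositionalEquality using (_≡_)
open import Function.Bundles using (_⇔_)

open import Data.Nat using (suc; NonZero; >-nonZero⁻¹; _<?_; _+_; _≤_; _<_; _>_; z≤n; s≤s)
open import Data.Nat.Properties
open import Data.Nat.Divisibility using (_∣_; _∣?_; divides; ∣-trans; m∣m*n)
open import Data.Nat.Combinatorics using (k![n∸k]!∣n!)
open import Data.Nat.Tactic.RingSolver using (solve-∀)
open import Data.List using (List; []; _∷_)
open import Data.Nat.ListAction using (sum)
open import Data.List.Relation.Unary.All using (All; []; _∷_)
open import Data.List.Relation.Unary.Linked using (Linked; [-]; _∷_)
open import Data.Sum using (inj₁; inj₂)
open import Data.Empty using (⊥-elim)
open import Function.Bundles using (mk⇔)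
open import Function.Base using (it)
open import Relation.Nullary using (contradiction)
open import Relation.Nullary.Decidable using (yes; no; True; toWitness)
open import Relation.Binary.PropositionalEquality using (_≢_; refl; sym; trans; subst)

σ-upto-step : ∀ m k → σ-upto m k ≤ σ-upto m (suc k)
σ-upto-step m k with suc k ∣? m
... | yes _ = m≤n+m (σ-upto m k) (suc k)
... | no _  = ≤-refl

σ-upto-mono : ∀ m {j k} → j ≤ k → σ-upto m j ≤ σ-upto m k
σ-upto-mono m {k = 0} z≤n = ≤-refl
σ-upto-mono m {j} {suc k} j≤1+k with m≤n⇒m<n∨m≡n j≤1+k
... | inj₂ refl      = ≤-refl
... | inj₁ (s≤s j≤k) = ≤-trans (σ-upto-mono m j≤k) (σ-upto-step m k)

σ-upto-divisor : ∀ m d → suc d ∣ m → σ-upto m (suc d) ≡ suc d + σ-upto m d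
σ-upto-divisor m d d+1∣m with suc d ∣? m
... | yes _     = refl
... | no d+1∤m = contradiction d+1∣m d+1∤m

-- A strictly decreasing list of positive divisors of m whose entries are all
-- at most k (encoded as: suc k ∷ ds is strictly decreasing) has sum at most
-- σ-upto m k.
divisor-chain≤σ-upto : ∀ m k (ds : List ℕ) → Linked _>_ (suc k ∷ ds) →
                       All (_∣ m) ds → All (0 <_) ds → sum ds ≤ σ-upto m k
divisor-chain≤σ-upto m k [] _ _ _ = z≤n
divisor-chain≤σ-upto m k (suc d ∷ ds) (s≤s d<k ∷ chain) (d+1∣m ∷ ds∣m) (_ ∷ ds>0) =
  begin
    suc d + sum ds           ≤⟨ +-monoʳ-≤ (suc d) (divisor-chain≤σ-upto m d ds chain ds∣m ds>0) ⟩
    suc d + σ-upto m d       ≡⟨ σ-upto-divisor m d d+1∣m ⟨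
    σ-upto m (suc d)         ≤⟨ σ-upto-mono m d<k ⟩
    σ-upto m k               ∎
  where open ≤-Reasoning

-- Every positive multiple of 12 is abundant: 12b, 6b, 4b and 3b are distinct
-- divisors of 12b summing to 25b.
multiple-of-12-abundant : ∀ b .{{_ : NonZero b}} → 2 * (12 * b) < σ (12 * b)
multiple-of-12-abundant b =
  begin-strict
    2 * (12 * b)                 <⟨ m<m+n (2 * (12 * b)) (>-nonZero⁻¹ b) ⟩
    2 * (12 * b) + b             ≡⟨ split b ⟩
    sum quarters                 ≤⟨ divisor-chain≤σ-upto (12 * b) (12 * b) quarters decreasing divide positive ⟩
    σ (12 * b)                   ∎
  where
  open ≤-Reasoning

  quarters : List ℕ
  quarters = 12 * b ∷ 6 * b ∷ 4 * b ∷ 3 * b ∷ []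

  split : ∀ b → 2 * (12 * b) + b ≡ 12 * b + (6 * b + (4 * b + (3 * b + 0)))
  split = solve-∀

  scale : ∀ c c' → {True (c <? c')} → c * b < c' * b
  scale c c' {c<c'} = *-monoˡ-< b (toWitness c<c')

  decreasing : Linked _>_ (suc (12 * b) ∷ quarters)
  decreasing = ≤-refl ∷ scale 6 12 ∷ scale 4 6 ∷ scale 3 4 ∷ [-]

  positive : All (0 <_) quarters
  positive = scale 0 12 ∷ scale 0 6 ∷ scale 0 4 ∷ scale 0 3 ∷ []

  divide : All (_∣ 12 * b) quarters
  divide = divides 1 (q₁ b) ∷ divides 2 (q₂ b) ∷ divides 3 (q₃ b) ∷ divides 4 (q₄ b) ∷ []
    where
    q₁ : ∀ b → 12 * b ≡ 1 * (12 * b)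
    q₁ = solve-∀
    q₂ : ∀ b → 12 * b ≡ 2 * (6 * b)
    q₂ = solve-∀
    q₃ : ∀ b → 12 * b ≡ 3 * (4 * b)
    q₃ = solve-∀
    q₄ : ∀ b → 12 * b ≡ 4 * (3 * b)
    q₄ = solve-∀

multiple-of-12-not-perfect : ∀ m .{{_ : NonZero m}} → 12 ∣ m → σ m ≢ 2 * m
multiple-of-12-not-perfect m (divides b m≡b*12) perfect =
  <-irrefl (sym perfect′) (multiple-of-12-abundant b {{b≢0}})
  where
  m≡12b : m ≡ 12 * b
  m≡12b = trans m≡b*12 (*-comm b 12)

  b≢0 : NonZero b
  b≢0 = m*n≢0⇒n≢0 12 {{subst NonZero m≡12b it}}

  perfect′ : σ (12 * b) ≡ 2 * (12 * b)
  perfect′ = subst (λ x → σ x ≡ 2 * x) m≡12b perfect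

-- For n ≥ 4, 4! = 24 divides n!, hence so does 12.
twelve-divides-factorial : ∀ k → 12 ∣ (4 + k) !
twelve-divides-factorial k =
  ∣-trans (divides 2 refl) (∣-trans (m∣m*n (k !)) (k![n∸k]!∣n! {4 + k} {4} (m≤m+n 4 k)))

proposition5 : (n : ℕ) → (σ (n !) ≡ 2 * (n !)) ⇔ (n ≡ 3)
proposition5 n = mk⇔ (perfect⇒3 n) (λ { refl → refl })
  where
  perfect⇒3 : ∀ n → σ (n !) ≡ 2 * (n !) → n ≡ 3
  perfect⇒3 0 ()
  perfect⇒3 1 ()
  perfect⇒3 2 ()
  perfect⇒3 3 _ = refl
  perfect⇒3 (suc (suc (suc (suc k)))) perfect =
    ⊥-elim (multiple-of-12-not-perfect ((4 + k) !) {{(4 + k) !≢0}} (twelve-divides-factorial k) perfect)
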